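{- Let $G=(V,E)$ be a graph and $\bm{a}^{\mathrm{T}}\bm{x}\le a_0$ a facet inducing inequality of $\mathrm{CUT}^\square(G)$. Let $u_1v_1,\dots,u_tv_t$ be $t$ distinct edges of $G$. If the support graph of $\bm{a}$ has more than three nodes, then for every $i=1,\dots,t$ the inequality $\bm{a}^{\mathrm{T}}\bm{x}\le a_0$ is not completely supported by the edge set $\{u_il,v_il\mid l\in\mathrm{N}_G(u_i)\cap\mathrm{N}_G(v_i)\}$.
   Context: $\mathrm{N}_G(v)$ denotes the neighbourhood of node $v$ in $G$. For $S\subseteq V$, the cut vector $\bm{\delta}_G(S)\in\mathbb{R}^E$ has $uv$-coordinate $1$ if $|S\cap\{u,v\}|=1$ and $0$ otherwise; $\mathrm{CUT}^\square(G)$ is the convex hull of all cut vectors. Facet inducing means valid with the induced face a facet. The support graph of $\bm a\in\mathbb{R}^E$ has edge set $E(\bm a)=\{e\in E\mid a_e\ne0\}$ and node set the endpoints of these edges; the inequality $\bm a^{\mathrm T}\bm x\le a_0$ is completely supported by an edge set $D$ if $E(\bm a)\subseteq D$.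
   Formalization: The coefficients of $\bm a$, the right-hand side $a_0$ and the points of $\mathrm{CUT}^\square(G)$ are rational rather than real. -}

module Defs where

open import Data.Nat using (ℕ; zero; suc; _>_)
open import Data.Fin using (Fin; zero; suc)
open import Data.Fin.Subset using (Subset; ∣_∣)
open import Data.Fin.Properties using (any?)
open import Data.Vec using (tabulate)
open import Data.Bool using (Bool; true; false; _xor_)
open import Data.Product using (Σ; ∃; _×_; _,_; proj₁; proj₂)
open import Data.Sum using (_⊎_)
open import Data.Rational using (ℚ; 0ℚ; 1ℚ; _+_; _*_; _≤_; _≟_)
open import Relation.Nullary using (¬_; does)
open import Relation.Nullary.Decidable using (¬?; _×-dec_; _⊎-dec_)
open import Relation.Nullary using (Dec)
import Data.Fin as Fin
open import Relation.Binary.PropositionalEquality using (_≡_; _≢_)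

record Graph : Set where
  field
    n : ℕ
    m : ℕ
    ends : Fin m → Fin n × Fin n
    loopless : ∀ e → proj₁ (ends e) ≢ proj₂ (ends e)

  Joins : Fin m → Fin n → Fin n → Set
  Joins e u v = (ends e ≡ (u , v)) ⊎ (ends e ≡ (v , u))

  field
    simple : ∀ e f u v → Joins e u v → Joins f u v → e ≡ f

  Adjacent : Fin n → Fin n → Set
  Adjacent u v = ∃ λ e → Joins e u v

  _∈N_ : Fin n → Fin n → Set
  l ∈N v = Adjacent v l

  Endpoint : Fin n → Fin m → Set
  Endpoint v e = (proj₁ (ends e) ≡ v) ⊎ (proj₂ (ends e) ≡ v)

Σℚ : ∀ {k} → (Fin k → ℚ) → ℚ
Σℚ {zero} f = 0ℚ
Σℚ {suc k} f = f zero + Σℚ (λ i → f (suc i))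

module _ (G : Graph) where
  open Graph G

  EVec : Set
  EVec = Fin m → ℚ

  cutVec : (Fin n → Bool) → EVec
  cutVec S e with S (proj₁ (ends e)) xor S (proj₂ (ends e))
  ... | true = 1ℚ
  ... | false = 0ℚ

  InCUT : EVec → Set
  InCUT x = Σ ℕ λ k → Σ (Fin k → ℚ) λ μ → Σ (Fin k → (Fin n → Bool)) λ S →
              (∀ j → 0ℚ ≤ μ j) × (Σℚ μ ≡ 1ℚ) ×
              (∀ e → x e ≡ Σℚ (λ j → μ j * cutVec (S j) e))

  dot : EVec → EVec → ℚ
  dot a x = Σℚ (λ e → a e * x e)

  AffInd : ∀ {k} → (Fin k → EVec) → Set
  AffInd {k} p = ∀ (μ : Fin k → ℚ) → Σℚ μ ≡ 0ℚ →
                 (∀ e → Σℚ (λ j → μ j * p j e) ≡ 0ℚ) → ∀ j → μ j ≡ 0ℚ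

  HasAffInd : (EVec → Set) → ℕ → Set
  HasAffInd P k = Σ (Fin k → EVec) λ p → (∀ j → P (p j)) × AffInd p

  Valid : EVec → ℚ → Set
  Valid a a0 = ∀ x → InCUT x → dot a x ≤ a0

  Face : EVec → ℚ → EVec → Set
  Face a a0 x = InCUT x × (dot a x ≡ a0)

  -- facet inducing: valid and dim(face) = dim(CUT^□(G)) - 1, where the
  -- dimension of a set is (max number of affinely independent points) - 1
  FacetInducing : EVec → ℚ → Set
  FacetInducing a a0 = Valid a a0 × Σ ℕ λ d →
      HasAffInd InCUT (suc d) × ¬ HasAffInd InCUT (suc (suc d)) ×
      HasAffInd (Face a a0) d × ¬ HasAffInd (Face a a0) (suc d)

  supportNodes : EVec → Subset n
  supportNodes a = tabulate λ v →
    does (any? λ e → ¬? (a e ≟ 0ℚ) ×-dec endpointDec v e)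
    where
      endpointDec : ∀ v e → Dec (Endpoint v e)
      endpointDec v e = (proj₁ (ends e) Fin.≟ v) ⊎-dec (proj₂ (ends e) Fin.≟ v)

  CompletelySupportedBy : EVec → (Fin m → Set) → Set
  CompletelySupportedBy a D = ∀ e → a e ≢ 0ℚ → D e

  DEdges : Fin n → Fin n → Fin m → Set
  DEdges u v e = ∃ λ l → (l ∈N u) × (l ∈N v) × (Joins e u l ⊎ Joins e v l)

{-# OPTIONS --safe #-}
module Submission where

-- Let uv be the edge and suppose every edge in the support of a joins u or v to a
-- common neighbour of u and v.  Take a support node l ∉ {u, v}; then α = a(ul) and
-- β = a(vl) are not both 0, and b = α χ_ul + β χ_vl + γ χ_uv with
-- γ = max(0, α + β) − max(α, β) satisfies b·δ(S) ≤ max(0, α + β) on every cut, with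
-- equality after moving l to the right side of the cut.  As a − b vanishes on the
-- edges at l, moving l does not change (a − b)·δ(S), so a − b ≤ a0 − max(0, α + β)
-- is valid as well and the facet of a lies in the face of b.  A second support node
-- l' ∉ {u, v, l} gives a cut on the face of b that is off the facet: take a cut that
-- is slack for the triangle at l' and move l.  With a cut that is slack for b, the d
-- affinely independent points of the facet become d + 2 affinely independent points
-- of CUT□(G), one more than its dimension allows.

open import Defs
open import Algebra.Bundles using (CommutativeRing)
open import Data.Bool using (Bool; true; false; _xor_)
open import Data.Bool.Properties using (xor-comm; xor-annihilates-not)
open import Data.Fin using (Fin; zero; suc)
import Data.Fin as Fin
open import Data.Fin.Properties using (any?)
open import Data.Fin.Subset using (Subset; ∣_∣; _∈_; _∉_; _⊆_; _∪_; ⁅_⁆; inside; outside)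
open import Data.Fin.Subset.Properties
  using (_∈?_; p⊆q⇒∣p∣≤∣q∣; x∈p∪q⁺; x∉⁅y⁆⇒x≢y; ∣⁅x⁆∣≡1)
open import Data.Nat using (ℕ; _>_)
import Data.Nat as ℕ
import Data.Nat.Properties as ℕ
open import Data.Product using (Σ; ∃; ∃₂; _×_; _,_; proj₁; proj₂)
open import Data.Sum using (_⊎_; inj₁; inj₂; [_,_]′)
open import Data.Rational
  using (ℚ; 0ℚ; 1ℚ; _+_; _*_; _-_; -_; _≤_; _<_; _⊔_; _≟_; 1/_; NonZero; ≢-nonZero; nonNegative)
open import Data.Rational.Properties
open import Data.Vec using ([]; _∷_)
open import Data.Vec.Properties using (lookup∘tabulate; []=⇒lookup)
open import Data.Vec.Functional using (updateAt) renaming (_∷_ to _◂_)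
open import Data.Vec.Functional.Properties using (updateAt-updates; updateAt-minimal)
open import Function.Base using (_∘_)
open import Function.Definitions using (Injective)
open import Level using (0ℓ)
open import Relation.Binary.Definitions using (tri<; tri≈; tri>)
open import Relation.Binary.PropositionalEquality
  using (_≡_; _≢_; refl; sym; trans; cong; cong₂; subst; module ≡-Reasoning)
open import Relation.Nullary using (¬_; Dec; does; proof; yes; no; contradiction; ¬?)
open import Relation.Nullary.Reflects using (Reflects; invert)
open import Relation.Nullary.Decidable
  using (_×-dec_; _⊎-dec_; dec⇒maybe; decidable-stable)
open import Tactic.RingSolver using (solve-∀)
open import Tactic.RingSolver.Core.AlmostCommutativeRing
  using (AlmostCommutativeRing; fromCommutativeRing)
open import Algebra.Properties.Semiring.Sum (CommutativeRing.semiring +-*-commutativeRing)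
  using (sum; sum-cong-≗; ∑-distrib-+; ∑-comm; *-distribˡ-sum; *-distribʳ-sum)

ℚ-ring : AlmostCommutativeRing 0ℓ 0ℓ
ℚ-ring = fromCommutativeRing +-*-commutativeRing (λ x → dec⇒maybe (0ℚ ≟ x))

p+[q-p]≡q : ∀ p q → p + (q - p) ≡ q
p+[q-p]≡q = solve-∀ ℚ-ring

[p+q]-p≡q : ∀ p q → p + q - p ≡ q
[p+q]-p≡q = solve-∀ ℚ-ring

[p+q]-q≡p : ∀ p q → p + q - q ≡ p
[p+q]-q≡p = solve-∀ ℚ-ring

[p-q]+q≡p : ∀ p q → p - q + q ≡ p
[p-q]+q≡p = solve-∀ ℚ-ring

q+r≡p⇒r≡p-q : ∀ {p q r} → q + r ≡ p → r ≡ p - q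
q+r≡p⇒r≡p-q {q = q} {r} refl = sym ([p+q]-p≡q q r)

+-cancelʳ-≡ : ∀ {p q} r → p + r ≡ q + r → p ≡ q
+-cancelʳ-≡ {p} {q} r eq = trans (sym ([p+q]-q≡p p r)) (trans (cong (_- r) eq) ([p+q]-q≡p q r))

p-q≡0⇒p≡q : ∀ {p q} → p - q ≡ 0ℚ → p ≡ q
p-q≡0⇒p≡q {p} {q} eq = trans (sym ([p-q]+q≡p p q)) (trans (cong (_+ q) eq) (+-identityˡ q))

p≡q⇒p-q≡0 : ∀ {p q} → p ≡ q → p - q ≡ 0ℚ
p≡q⇒p-q≡0 {p} refl = +-inverseʳ p

p*q≡0⇒p≡0 : ∀ {p q} → q ≢ 0ℚ → p * q ≡ 0ℚ → p ≡ 0ℚ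
p*q≡0⇒p≡0 {p} {q} q≢0 pq≡0 = begin
  p                ≡⟨ sym (*-identityʳ p) ⟩
  p * 1ℚ           ≡⟨ cong (p *_) (sym (*-inverseʳ q)) ⟩
  p * (q * 1/ q)   ≡⟨ sym (*-assoc p q (1/ q)) ⟩
  p * q * 1/ q     ≡⟨ cong (_* 1/ q) pq≡0 ⟩
  0ℚ * 1/ q        ≡⟨ *-zeroˡ (1/ q) ⟩
  0ℚ               ∎
  where
  open ≡-Reasoning
  instance
    q-nonZero : NonZero q
    q-nonZero = ≢-nonZero q≢0

p+p≡0⇒p≡0 : ∀ {p} → p + p ≡ 0ℚ → p ≡ 0ℚ
p+p≡0⇒p≡0 {p} p+p≡0 with <-cmp p 0ℚ
... | tri< p<0 _ _ = contradiction p+p≡0 (<⇒≢ (+-mono-< p<0 p<0))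
... | tri≈ _ p≡0 _ = p≡0
... | tri> _ _ p>0 = contradiction (sym p+p≡0) (<⇒≢ (+-mono-< p>0 p>0))

≤∧≢⇒< : ∀ {p q} → p ≤ q → p ≢ q → p < q
≤∧≢⇒< {p} {q} p≤q p≢q with <-cmp p q
... | tri< p<q _ _ = p<q
... | tri≈ _ p≡q _ = contradiction p≡q p≢q
... | tri> _ _ q<p = contradiction (<-≤-trans q<p p≤q) (<-irrefl refl)

+-tightˡ : ∀ {p q r s} → p ≤ r → q ≤ s → p + q ≡ r + s → p ≡ r
+-tightˡ {p} {q} {r} p≤r q≤s eq with <-cmp p r
... | tri< p<r _ _ = contradiction eq (<⇒≢ (+-mono-<-≤ p<r q≤s))
... | tri≈ _ p≡r _ = p≡r
... | tri> _ _ r<p = contradiction (<-≤-trans r<p p≤r) (<-irrefl refl)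

fromBool : Bool → ℚ
fromBool true  = 1ℚ
fromBool false = 0ℚ

xor-cancelˡ : ∀ r p q → (r xor p) xor (r xor q) ≡ p xor q
xor-cancelˡ false p q = refl
xor-cancelˡ true  p q = xor-annihilates-not p q

Σℚ≡sum : ∀ {k} (f : Fin k → ℚ) → Σℚ f ≡ sum f
Σℚ≡sum {ℕ.zero}  f = refl
Σℚ≡sum {ℕ.suc k} f = cong (f zero +_) (Σℚ≡sum (f ∘ suc))

Σℚ-cong : ∀ {k} {f g : Fin k → ℚ} → (∀ i → f i ≡ g i) → Σℚ f ≡ Σℚ g
Σℚ-cong {f = f} {g} f≗g rewrite Σℚ≡sum f | Σℚ≡sum g = sum-cong-≗ f≗g

Σℚ-zero : ∀ {k} {f : Fin k → ℚ} → (∀ i → f i ≡ 0ℚ) → Σℚ f ≡ 0ℚ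
Σℚ-zero {ℕ.zero}  f≡0 = refl
Σℚ-zero {ℕ.suc k} f≡0 = trans (cong₂ _+_ (f≡0 zero) (Σℚ-zero (f≡0 ∘ suc))) (+-identityˡ 0ℚ)

Σℚ-distrib-+ : ∀ {k} (f g : Fin k → ℚ) → Σℚ (λ i → f i + g i) ≡ Σℚ f + Σℚ g
Σℚ-distrib-+ f g rewrite Σℚ≡sum (λ i → f i + g i) | Σℚ≡sum f | Σℚ≡sum g = ∑-distrib-+ f g

Σℚ-*ˡ : ∀ {k} x (f : Fin k → ℚ) → Σℚ (λ i → x * f i) ≡ x * Σℚ f
Σℚ-*ˡ x f rewrite Σℚ≡sum (λ i → x * f i) | Σℚ≡sum f = sym (*-distribˡ-sum x f)

Σℚ-*ʳ : ∀ {k} x (f : Fin k → ℚ) → Σℚ (λ i → f i * x) ≡ Σℚ f * x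
Σℚ-*ʳ x f rewrite Σℚ≡sum (λ i → f i * x) | Σℚ≡sum f = sym (*-distribʳ-sum x f)

Σℚ-comm : ∀ {k l} (F : Fin k → Fin l → ℚ) →
          Σℚ (λ i → Σℚ (λ j → F i j)) ≡ Σℚ (λ j → Σℚ (λ i → F i j))
Σℚ-comm F = begin
  Σℚ (λ i → Σℚ (λ j → F i j))  ≡⟨ Σℚ-cong (λ i → Σℚ≡sum (F i)) ⟩
  Σℚ (λ i → sum (F i))          ≡⟨ Σℚ≡sum (λ i → sum (F i)) ⟩
  sum (λ i → sum (F i))         ≡⟨ ∑-comm F ⟩
  sum (λ j → sum (λ i → F i j)) ≡⟨ Σℚ≡sum (λ j → sum (λ i → F i j)) ⟨
  Σℚ (λ j → sum (λ i → F i j))  ≡⟨ Σℚ-cong (λ j → Σℚ≡sum (λ i → F i j)) ⟨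
  Σℚ (λ j → Σℚ (λ i → F i j))   ∎
  where open ≡-Reasoning

Σℚ-mono-≤ : ∀ {k} {f g : Fin k → ℚ} → (∀ i → f i ≤ g i) → Σℚ f ≤ Σℚ g
Σℚ-mono-≤ {ℕ.zero}  f≤g = ≤-refl
Σℚ-mono-≤ {ℕ.suc k} f≤g = +-mono-≤ (f≤g zero) (Σℚ-mono-≤ (f≤g ∘ suc))

Σℚ-tail : ∀ {k} (f : Fin (ℕ.suc k) → ℚ) → f zero ≡ 0ℚ → Σℚ f ≡ 0ℚ → Σℚ (f ∘ suc) ≡ 0ℚ
Σℚ-tail f f₀≡0 Σf≡0 =
  trans (sym (+-identityˡ _)) (trans (cong (_+ Σℚ (f ∘ suc)) (sym f₀≡0)) Σf≡0)

single : ∀ {k} → Fin k → ℚ → Fin k → ℚ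
single i x = updateAt (λ _ → 0ℚ) i (λ _ → x)

single-≢ : ∀ {k} {i j : Fin k} x → i ≢ j → single i x j ≡ 0ℚ
single-≢ {i = i} {j} x i≢j = updateAt-minimal j i (λ _ → 0ℚ) (i≢j ∘ sym)

single-≡ : ∀ {k} (i : Fin k) x → single i x i ≡ x
single-≡ i x = updateAt-updates i (λ _ → 0ℚ)

Σℚ-single : ∀ {k} (i : Fin k) x (f : Fin k → ℚ) → Σℚ (λ j → single i x j * f j) ≡ x * f i
Σℚ-single zero    x f =
  trans (cong (x * f zero +_) (Σℚ-zero (λ j → *-zeroˡ (f (suc j))))) (+-identityʳ _)
Σℚ-single (suc i) x f =
  trans (cong₂ _+_ (*-zeroˡ (f zero)) (Σℚ-single i x (f ∘ suc))) (+-identityˡ _)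

_[_]≔_ : ∀ {k} {A : Set} → (Fin k → A) → Fin k → A → Fin k → A
S [ l ]≔ x = updateAt S l (λ _ → x)

∣p∪q∣≤∣p∣+∣q∣ : ∀ {k} (p q : Subset k) → ∣ p ∪ q ∣ ℕ.≤ ∣ p ∣ ℕ.+ ∣ q ∣
∣p∪q∣≤∣p∣+∣q∣ []            []            = ℕ.z≤n
∣p∪q∣≤∣p∣+∣q∣ (outside ∷ p) (outside ∷ q) = ∣p∪q∣≤∣p∣+∣q∣ p q
∣p∪q∣≤∣p∣+∣q∣ (outside ∷ p) (inside  ∷ q) =
  ℕ.≤-trans (ℕ.s≤s (∣p∪q∣≤∣p∣+∣q∣ p q)) (ℕ.≤-reflexive (sym (ℕ.+-suc ∣ p ∣ ∣ q ∣)))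
∣p∪q∣≤∣p∣+∣q∣ (inside  ∷ p) (outside ∷ q) = ℕ.s≤s (∣p∪q∣≤∣p∣+∣q∣ p q)
∣p∪q∣≤∣p∣+∣q∣ (inside  ∷ p) (inside  ∷ q) =
  ℕ.s≤s (ℕ.≤-trans (∣p∪q∣≤∣p∣+∣q∣ p q) (ℕ.+-monoʳ-≤ ∣ p ∣ (ℕ.n≤1+n ∣ q ∣)))

∣⁅x⁆∪p∣≤1+∣p∣ : ∀ {k} (x : Fin k) (p : Subset k) → ∣ ⁅ x ⁆ ∪ p ∣ ℕ.≤ ℕ.suc ∣ p ∣
∣⁅x⁆∪p∣≤1+∣p∣ x p =
  ℕ.≤-trans (∣p∪q∣≤∣p∣+∣q∣ ⁅ x ⁆ p) (ℕ.≤-reflexive (cong (ℕ._+ ∣ p ∣) (∣⁅x⁆∣≡1 x)))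

∣⁅x⁆∪⁅y⁆∣≤2 : ∀ {k} (x y : Fin k) → ∣ ⁅ x ⁆ ∪ ⁅ y ⁆ ∣ ℕ.≤ 2
∣⁅x⁆∪⁅y⁆∣≤2 x y = ℕ.≤-trans (∣⁅x⁆∪p∣≤1+∣p∣ x ⁅ y ⁆) (ℕ.≤-reflexive (cong ℕ.suc (∣⁅x⁆∣≡1 y)))

∣q∣<∣p∣⇒∃∈p∉q : ∀ {k} (p q : Subset k) → ∣ q ∣ ℕ.< ∣ p ∣ → ∃ λ x → x ∈ p × x ∉ q
∣q∣<∣p∣⇒∃∈p∉q p q ∣q∣<∣p∣ with any? (λ x → (x ∈? p) ×-dec ¬? (x ∈? q))
... | yes found = found
... | no ∄ = contradiction (p⊆q⇒∣p∣≤∣q∣ p⊆q) (ℕ.<⇒≱ ∣q∣<∣p∣)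
  where
  p⊆q : p ⊆ q
  p⊆q {x} x∈p = decidable-stable (x ∈? q) (λ x∉q → ∄ (x , x∈p , x∉q))

∉⁅x⁆∪p⇒≢ : ∀ {k} {x y : Fin k} {p : Subset k} → y ∉ ⁅ x ⁆ ∪ p → y ≢ x
∉⁅x⁆∪p⇒≢ y∉ = x∉⁅y⁆⇒x≢y (y∉ ∘ x∈p∪q⁺ ∘ inj₁)

∉p∪q⇒∉q : ∀ {k} {x : Fin k} {p q : Subset k} → x ∉ p ∪ q → x ∉ q
∉p∪q⇒∉q x∉ = x∉ ∘ x∈p∪q⁺ ∘ inj₂

∣p∣>3⇒two-others : ∀ {k} (p : Subset k) (u v : Fin k) → ∣ p ∣ > 3 →
  ∃₂ λ w₁ w₂ → w₁ ∈ p × w₂ ∈ p × w₁ ≢ u × w₁ ≢ v × w₂ ≢ u × w₂ ≢ v × w₁ ≢ w₂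
∣p∣>3⇒two-others p u v 3<∣p∣
  with ∣q∣<∣p∣⇒∃∈p∉q p (⁅ u ⁆ ∪ ⁅ v ⁆) (ℕ.≤-<-trans (∣⁅x⁆∪⁅y⁆∣≤2 u v) (ℕ.<-trans (ℕ.n<1+n 2) 3<∣p∣))
... | w₁ , w₁∈p , w₁∉
  with ∣q∣<∣p∣⇒∃∈p∉q p (⁅ w₁ ⁆ ∪ (⁅ u ⁆ ∪ ⁅ v ⁆))
         (ℕ.≤-<-trans (ℕ.≤-trans (∣⁅x⁆∪p∣≤1+∣p∣ w₁ _) (ℕ.s≤s (∣⁅x⁆∪⁅y⁆∣≤2 u v))) 3<∣p∣)
... | w₂ , w₂∈p , w₂∉ =
  w₁ , w₂ , w₁∈p , w₂∈p ,
  ∉⁅x⁆∪p⇒≢ w₁∉ , x∉⁅y⁆⇒x≢y (∉p∪q⇒∉q w₁∉) ,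
  ∉⁅x⁆∪p⇒≢ (∉p∪q⇒∉q w₂∉) , x∉⁅y⁆⇒x≢y (∉p∪q⇒∉q (∉p∪q⇒∉q w₂∉)) , ∉⁅x⁆∪p⇒≢ w₂∉ ∘ sym

module TriangleBound (α β : ℚ) where

  top : ℚ
  top = 0ℚ ⊔ (α + β)

  γ : ℚ
  γ = top - (α ⊔ β)

  -- tri p q is the value of α x_ul + β x_vl + γ x_uv on a cut that separates
  -- l from u iff p and l from v iff q.
  tri : Bool → Bool → ℚ
  tri false false = 0ℚ
  tri true  true  = α + β
  tri true  false = α + γ
  tri false true  = β + γ

  tri-linear : ∀ p q → α * fromBool p + (β * fromBool q + γ * fromBool (p xor q)) ≡ tri p q
  tri-linear false false = identity α β γ
    where identity : ∀ x y z → x * 0ℚ + (y * 0ℚ + z * 0ℚ) ≡ 0ℚ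
          identity = solve-∀ ℚ-ring
  tri-linear true  true  = identity α β γ
    where identity : ∀ x y z → x * 1ℚ + (y * 1ℚ + z * 0ℚ) ≡ x + y
          identity = solve-∀ ℚ-ring
  tri-linear true  false = identity α β γ
    where identity : ∀ x y z → x * 1ℚ + (y * 0ℚ + z * 1ℚ) ≡ x + z
          identity = solve-∀ ℚ-ring
  tri-linear false true  = identity α β γ
    where identity : ∀ x y z → x * 0ℚ + (y * 1ℚ + z * 1ℚ) ≡ y + z
          identity = solve-∀ ℚ-ring

  ⊔+γ≡top : α ⊔ β + γ ≡ top
  ⊔+γ≡top = p+[q-p]≡q (α ⊔ β) top

  ≤⊔⇒+γ≤top : ∀ {x} → x ≤ α ⊔ β → x + γ ≤ top
  ≤⊔⇒+γ≤top x≤⊔ = ≤-trans (+-monoˡ-≤ γ x≤⊔) (≤-reflexive ⊔+γ≡top)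

  ≡⊔⇒+γ≡top : ∀ {x} → α ⊔ β ≡ x → x + γ ≡ top
  ≡⊔⇒+γ≡top ⊔≡x = trans (cong (_+ γ) (sym ⊔≡x)) ⊔+γ≡top

  tri≤top : ∀ p q → tri p q ≤ top
  tri≤top false false = p≤p⊔q 0ℚ (α + β)
  tri≤top true  true  = p≤q⊔p 0ℚ (α + β)
  tri≤top true  false = ≤⊔⇒+γ≤top (p≤p⊔q α β)
  tri≤top false true  = ≤⊔⇒+γ≤top (p≤q⊔p α β)

  tri-tight : ∀ p q → ∃ λ x → tri (x xor p) (x xor q) ≡ top
  tri-tight false false with ⊔-sel 0ℚ (α + β)
  ... | inj₁ top≡0   = false , sym top≡0
  ... | inj₂ top≡α+β = true  , sym top≡α+β
  tri-tight true  true  with ⊔-sel 0ℚ (α + β)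
  ... | inj₁ top≡0   = true  , sym top≡0
  ... | inj₂ top≡α+β = false , sym top≡α+β
  tri-tight true  false with ⊔-sel α β
  ... | inj₁ ⊔≡α = false , ≡⊔⇒+γ≡top ⊔≡α
  ... | inj₂ ⊔≡β = true  , ≡⊔⇒+γ≡top ⊔≡β
  tri-tight false true  with ⊔-sel α β
  ... | inj₁ ⊔≡α = true  , ≡⊔⇒+γ≡top ⊔≡α
  ... | inj₂ ⊔≡β = false , ≡⊔⇒+γ≡top ⊔≡β

  tri-slack : α ≢ 0ℚ ⊎ β ≢ 0ℚ → ∃₂ λ p q → tri p q < top
  tri-slack α≢0⊎β≢0
    with tri false false ≟ top | tri true true ≟ top | tri true false ≟ top | tri false true ≟ top
  ... | no ≢top | _ | _ | _ = false , false , ≤∧≢⇒< (tri≤top false false) ≢top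
  ... | _ | no ≢top | _ | _ = true  , true  , ≤∧≢⇒< (tri≤top true true) ≢top
  ... | _ | _ | no ≢top | _ = true  , false , ≤∧≢⇒< (tri≤top true false) ≢top
  ... | _ | _ | _ | no ≢top = false , true  , ≤∧≢⇒< (tri≤top false true) ≢top
  ... | yes ff | yes tt | yes tf | yes ft = [ contradiction α≡0 , contradiction β≡0 ]′ α≢0⊎β≢0
    where
    α≡β : α ≡ β
    α≡β = +-cancelʳ-≡ γ (trans tf (sym ft))
    α≡0 : α ≡ 0ℚ
    α≡0 = p+p≡0⇒p≡0 (trans (cong (α +_) α≡β) (trans tt (sym ff)))
    β≡0 : β ≡ 0ℚ
    β≡0 = trans (sym α≡β) α≡0

module _ (G : Graph) where
  open Graph G

  Joins-sym : ∀ {f x y} → Joins f x y → Joins f y x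
  Joins-sym (inj₁ ends≡) = inj₂ ends≡
  Joins-sym (inj₂ ends≡) = inj₁ ends≡

  Joins⇒≢ : ∀ {f x y} → Joins f x y → x ≢ y
  Joins⇒≢ {f} (inj₁ refl) = loopless f
  Joins⇒≢ {f} (inj₂ refl) = loopless f ∘ sym

  Joins⇒Endpointˡ : ∀ {f x y} → Joins f x y → Endpoint x f
  Joins⇒Endpointˡ (inj₁ ends≡) = inj₁ (cong proj₁ ends≡)
  Joins⇒Endpointˡ (inj₂ ends≡) = inj₂ (cong proj₂ ends≡)

  Endpoint-Joins : ∀ {f x y w} → Joins f x y → Endpoint w f → w ≡ x ⊎ w ≡ y
  Endpoint-Joins (inj₁ ends≡) (inj₁ refl) = inj₁ (cong proj₁ ends≡)
  Endpoint-Joins (inj₁ ends≡) (inj₂ refl) = inj₂ (cong proj₂ ends≡)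
  Endpoint-Joins (inj₂ ends≡) (inj₁ refl) = inj₂ (cong proj₁ ends≡)
  Endpoint-Joins (inj₂ ends≡) (inj₂ refl) = inj₁ (cong proj₂ ends≡)

  Endpoint⇒≢ : ∀ {e f x y w} → Joins e x y → w ≢ x → w ≢ y → Endpoint w f → e ≢ f
  Endpoint⇒≢ e:xy w≢x w≢y w∈f refl = [ w≢x , w≢y ]′ (Endpoint-Joins e:xy w∈f)

  endpoint? : ∀ w f → Dec (Endpoint w f)
  endpoint? w f = (proj₁ (ends f) Fin.≟ w) ⊎-dec (proj₂ (ends f) Fin.≟ w)

  DEdges-through : ∀ {u v w f} → DEdges G u v f → Endpoint w f → w ≢ u → w ≢ v →
                   w ∈N u × w ∈N v × (Joins f u w ⊎ Joins f v w)
  DEdges-through (l , l∈Nu , l∈Nv , inj₁ f:ul) w∈f w≢u w≢v with Endpoint-Joins f:ul w∈f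
  ... | inj₁ w≡u  = contradiction w≡u w≢u
  ... | inj₂ refl = l∈Nu , l∈Nv , inj₁ f:ul
  DEdges-through (l , l∈Nu , l∈Nv , inj₂ f:vl) w∈f w≢u w≢v with Endpoint-Joins f:vl w∈f
  ... | inj₁ w≡v  = contradiction w≡v w≢v
  ... | inj₂ refl = l∈Nu , l∈Nv , inj₂ f:vl

  ∈supportNodes⇒edge : ∀ {a w} → w ∈ supportNodes G a → ∃ λ f → a f ≢ 0ℚ × Endpoint w f
  ∈supportNodes⇒edge {a} {w} w∈ = invert (subst (Reflects _) in-support (proof support?))
    where
    support? : Dec (∃ λ f → a f ≢ 0ℚ × Endpoint w f)
    support? = any? (λ f → ¬? (a f ≟ 0ℚ) ×-dec endpoint? w f)
    in-support : does support? ≡ true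
    in-support = trans (sym (lookup∘tabulate _ w)) ([]=⇒lookup w∈)

  cutVec-fromBool : ∀ S f → cutVec G S f ≡ fromBool (S (proj₁ (ends f)) xor S (proj₂ (ends f)))
  cutVec-fromBool S f with S (proj₁ (ends f)) xor S (proj₂ (ends f))
  ... | true  = refl
  ... | false = refl

  cutVec-Joins : ∀ S {f x y} → Joins f x y → cutVec G S f ≡ fromBool (S x xor S y)
  cutVec-Joins S {f} (inj₁ ends≡) =
    trans (cutVec-fromBool S f) (cong (λ xy → fromBool (S (proj₁ xy) xor S (proj₂ xy))) ends≡)
  cutVec-Joins S {f} {x} {y} (inj₂ ends≡) =
    trans (cutVec-fromBool S f)
      (trans (cong (λ yx → fromBool (S (proj₁ yx) xor S (proj₂ yx))) ends≡)
             (cong fromBool (xor-comm (S y) (S x))))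

  cutVec-[]≔ : ∀ S {l} x {f} → ¬ Endpoint l f → cutVec G (S [ l ]≔ x) f ≡ cutVec G S f
  cutVec-[]≔ S {l} x {f} l∉f = begin
    cutVec G (S [ l ]≔ x) f
      ≡⟨ cutVec-fromBool (S [ l ]≔ x) f ⟩
    fromBool ((S [ l ]≔ x) (proj₁ (ends f)) xor (S [ l ]≔ x) (proj₂ (ends f)))
      ≡⟨ cong₂ (λ p q → fromBool (p xor q)) (unmoved (l∉f ∘ inj₁)) (unmoved (l∉f ∘ inj₂)) ⟩
    fromBool (S (proj₁ (ends f)) xor S (proj₂ (ends f)))
      ≡⟨ cutVec-fromBool S f ⟨
    cutVec G S f ∎
    where
    open ≡-Reasoning
    unmoved : ∀ {w} → w ≢ l → (S [ l ]≔ x) w ≡ S w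
    unmoved {w} w≢l = updateAt-minimal w l S w≢l

  cutVec∈CUT : ∀ S → InCUT G (cutVec G S)
  cutVec∈CUT S = 1 , (λ _ → 1ℚ) , (λ _ → S) , (λ _ → nonNegative⁻¹ 1ℚ) , refl ,
                 λ e → sym (trans (+-identityʳ _) (*-identityˡ _))

  ValidOnCuts : EVec G → ℚ → Set
  ValidOnCuts a a0 = ∀ S → dot G a (cutVec G S) ≤ a0

  Valid⇒ValidOnCuts : ∀ {a a0} → Valid G a a0 → ValidOnCuts a a0
  Valid⇒ValidOnCuts valid S = valid (cutVec G S) (cutVec∈CUT S)

  dot-+ˡ : ∀ (g h y : EVec G) → dot G (λ f → g f + h f) y ≡ dot G g y + dot G h y
  dot-+ˡ g h y = trans (Σℚ-cong (λ f → *-distribʳ-+ (y f) (g f) (h f)))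
                       (Σℚ-distrib-+ (λ f → g f * y f) (λ f → h f * y f))

  dot-split : ∀ (a b y : EVec G) → dot G a y ≡ dot G b y + dot G (λ f → a f - b f) y
  dot-split a b y = trans (Σℚ-cong (λ f → cong (_* y f) (split (a f) (b f))))
                          (dot-+ˡ b (λ f → a f - b f) y)
    where
    split : ∀ p q → p ≡ q + (p - q)
    split = solve-∀ ℚ-ring

  dot-subˡ : ∀ (a b y : EVec G) → dot G (λ f → a f - b f) y ≡ dot G a y - dot G b y
  dot-subˡ a b y = q+r≡p⇒r≡p-q (sym (dot-split a b y))

  dot-single : ∀ e x (y : EVec G) → dot G (single e x) y ≡ x * y e
  dot-single = Σℚ-single

  dot-linear : ∀ {k} (h : EVec G) (μ : Fin k → ℚ) (p : Fin k → EVec G) →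
               dot G h (λ e → Σℚ (λ j → μ j * p j e)) ≡ Σℚ (λ j → μ j * dot G h (p j))
  dot-linear h μ p = begin
    Σℚ (λ e → h e * Σℚ (λ j → μ j * p j e))   ≡⟨ Σℚ-cong (λ e → Σℚ-*ˡ (h e) (λ j → μ j * p j e)) ⟨
    Σℚ (λ e → Σℚ (λ j → h e * (μ j * p j e))) ≡⟨ Σℚ-comm (λ e j → h e * (μ j * p j e)) ⟩
    Σℚ (λ j → Σℚ (λ e → h e * (μ j * p j e))) ≡⟨ Σℚ-cong (λ j → Σℚ-cong (λ e → swap (h e) (μ j) _)) ⟩
    Σℚ (λ j → Σℚ (λ e → μ j * (h e * p j e))) ≡⟨ Σℚ-cong (λ j → Σℚ-*ˡ (μ j) (λ e → h e * p j e)) ⟩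
    Σℚ (λ j → μ j * dot G h (p j))             ∎
    where
    open ≡-Reasoning
    swap : ∀ x y z → x * (y * z) ≡ y * (x * z)
    swap = solve-∀ ℚ-ring

  ValidOnCuts⇒Valid : ∀ {a a0} → ValidOnCuts a a0 → Valid G a a0
  ValidOnCuts⇒Valid {a} {a0} valid x (k , μ , S , μ≥0 , Σμ≡1 , x≡Σμδ) = begin
    dot G a x                                    ≡⟨ Σℚ-cong (λ e → cong (a e *_) (x≡Σμδ e)) ⟩
    dot G a (λ e → Σℚ (λ j → μ j * cutVec G (S j) e)) ≡⟨ dot-linear a μ (cutVec G ∘ S) ⟩
    Σℚ (λ j → μ j * dot G a (cutVec G (S j)))    ≤⟨ Σℚ-mono-≤ (λ j → μ-monotone j (valid (S j))) ⟩
    Σℚ (λ j → μ j * a0)                           ≡⟨ Σℚ-*ʳ a0 μ ⟩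
    Σℚ μ * a0                                     ≡⟨ cong (_* a0) Σμ≡1 ⟩
    1ℚ * a0                                       ≡⟨ *-identityˡ a0 ⟩
    a0                                            ∎
    where
    open ≤-Reasoning
    μ-monotone : ∀ j {p q} → p ≤ q → μ j * p ≤ μ j * q
    μ-monotone j = *-monoˡ-≤-nonNeg (μ j) {{nonNegative (μ≥0 j)}}

  dot-cutVec-[]≔ : ∀ {h : EVec G} {l} → (∀ f → Endpoint l f → h f ≡ 0ℚ) →
                   ∀ S x → dot G h (cutVec G (S [ l ]≔ x)) ≡ dot G h (cutVec G S)
  dot-cutVec-[]≔ {h} {l} h≡0-at-l S x = Σℚ-cong same
    where
    same : ∀ f → h f * cutVec G (S [ l ]≔ x) f ≡ h f * cutVec G S f
    same f with endpoint? l f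
    ... | yes l∈f rewrite h≡0-at-l f l∈f =
      trans (*-zeroˡ (cutVec G (S [ l ]≔ x) f)) (sym (*-zeroˡ (cutVec G S f)))
    ... | no  l∉f = cong (h f *_) (cutVec-[]≔ S x l∉f)

  Face⇒tight : ∀ {a a0 b b0} → ValidOnCuts b b0 → ValidOnCuts (λ f → a f - b f) (a0 - b0) →
               ∀ x → Face G a a0 x → dot G b x ≡ b0
  Face⇒tight {a} {a0} {b} {b0} b-valid rest-valid x (x∈CUT , ax≡a0) =
    +-tightˡ (ValidOnCuts⇒Valid {b} b-valid x x∈CUT)
             (ValidOnCuts⇒Valid {λ f → a f - b f} rest-valid x x∈CUT) (begin
      dot G b x + dot G (λ f → a f - b f) x ≡⟨ dot-split a b x ⟨
      dot G a x                            ≡⟨ ax≡a0 ⟩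
      a0                                   ≡⟨ p+[q-p]≡q b0 a0 ⟨
      b0 + (a0 - b0)                       ∎)
    where open ≡-Reasoning

  affineDependence-annihilates :
    ∀ {k} (p : Fin k → EVec G) (μ : Fin k → ℚ) (h : EVec G) (h0 : ℚ) →
    Σℚ μ ≡ 0ℚ → (∀ e → Σℚ (λ j → μ j * p j e) ≡ 0ℚ) →
    Σℚ (λ j → μ j * (dot G h (p j) - h0)) ≡ 0ℚ
  affineDependence-annihilates p μ h h0 Σμ≡0 Σμp≡0 = begin
    Σℚ (λ j → μ j * (dot G h (p j) - h0))
      ≡⟨ Σℚ-cong (λ j → *-distribˡ-+ (μ j) (dot G h (p j)) (- h0)) ⟩
    Σℚ (λ j → μ j * dot G h (p j) + μ j * (- h0))
      ≡⟨ Σℚ-distrib-+ (λ j → μ j * dot G h (p j)) (λ j → μ j * (- h0)) ⟩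
    Σℚ (λ j → μ j * dot G h (p j)) + Σℚ (λ j → μ j * (- h0))
      ≡⟨ cong₂ _+_ (sym (dot-linear h μ p)) (Σℚ-*ʳ (- h0) μ) ⟩
    dot G h (λ e → Σℚ (λ j → μ j * p j e)) + Σℚ μ * (- h0)
      ≡⟨ cong₂ _+_ (Σℚ-zero (λ e → trans (cong (h e *_) (Σμp≡0 e)) (*-zeroʳ (h e))))
                   (trans (cong (_* (- h0)) Σμ≡0) (*-zeroˡ (- h0))) ⟩
    0ℚ + 0ℚ
      ≡⟨ +-identityˡ 0ℚ ⟩
    0ℚ ∎
    where open ≡-Reasoning

  AffInd-◂ : ∀ {k} {p : Fin k → EVec G} {h : EVec G} {h0 : ℚ} {x : EVec G} →
             AffInd G p → (∀ j → dot G h (p j) ≡ h0) → dot G h x ≢ h0 → AffInd G (x ◂ p)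
  AffInd-◂ {p = p} {h} {h0} {x} p-indep p-on x-off μ Σμ≡0 Σμp≡0 = μ≡0
    where
    open ≡-Reasoning
    μ₀≡0 : μ zero ≡ 0ℚ
    μ₀≡0 = p*q≡0⇒p≡0 (x-off ∘ p-q≡0⇒p≡q) (begin
      μ zero * (dot G h x - h0)
        ≡⟨ +-identityʳ _ ⟨
      μ zero * (dot G h x - h0) + 0ℚ
        ≡⟨ cong (μ zero * (dot G h x - h0) +_) (Σℚ-zero tail≡0) ⟨
      Σℚ (λ j → μ j * (dot G h ((x ◂ p) j) - h0))
        ≡⟨ affineDependence-annihilates (x ◂ p) μ h h0 Σμ≡0 Σμp≡0 ⟩
      0ℚ ∎)
      where
      tail≡0 : ∀ j → μ (suc j) * (dot G h (p j) - h0) ≡ 0ℚ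
      tail≡0 j = trans (cong (μ (suc j) *_) (p≡q⇒p-q≡0 (p-on j))) (*-zeroʳ (μ (suc j)))
    μ≡0 : ∀ j → μ j ≡ 0ℚ
    μ≡0 zero    = μ₀≡0
    μ≡0 (suc j) = p-indep (μ ∘ suc) (Σℚ-tail μ μ₀≡0 Σμ≡0) Σμ′p≡0 j
      where
      Σμ′p≡0 : ∀ e → Σℚ (λ i → μ (suc i) * p i e) ≡ 0ℚ
      Σμ′p≡0 e = Σℚ-tail (λ i → μ i * (x ◂ p) i e)
                         (trans (cong (_* x e) μ₀≡0) (*-zeroˡ (x e))) (Σμp≡0 e)

  HasAffInd-Face+2 : ∀ {a a0 b b0 d} → HasAffInd G (Face G a a0) d →
    (∀ x → Face G a a0 x → dot G b x ≡ b0) →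
    ∀ {q r} → InCUT G q → InCUT G r → dot G b q ≡ b0 → dot G a q ≢ a0 → dot G b r ≢ b0 →
    HasAffInd G (InCUT G) (ℕ.suc (ℕ.suc d))
  HasAffInd-Face+2 {a} {a0} {b} {b0} (ps , ps∈Face , ps-indep) Face⇒b≡b0 {q} {r}
                   q∈CUT r∈CUT q-on-b q-off-a r-off-b =
    r ◂ (q ◂ ps) , members ,
    AffInd-◂ {h = b} (AffInd-◂ {p = ps} {h = a} ps-indep (proj₂ ∘ ps∈Face) q-off-a) on-b r-off-b
    where
    members : ∀ j → InCUT G ((r ◂ (q ◂ ps)) j)
    members zero          = r∈CUT
    members (suc zero)    = q∈CUT
    members (suc (suc j)) = proj₁ (ps∈Face j)
    on-b : ∀ j → dot G b ((q ◂ ps) j) ≡ b0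
    on-b zero    = q-on-b
    on-b (suc j) = Face⇒b≡b0 (ps j) (ps∈Face j)

  record Triangle (u v l : Fin n) : Set where
    field
      uv ul vl : Fin m
      uv-joins : Joins uv u v
      ul-joins : Joins ul u l
      vl-joins : Joins vl v l
      l≢u : l ≢ u
      l≢v : l ≢ v

  supportNode⇒Triangle : ∀ {a u v l e} → CompletelySupportedBy G a (DEdges G u v) → Joins e u v →
    l ∈ supportNodes G a → l ≢ u → l ≢ v →
    Σ (Triangle u v l) λ T → a (Triangle.ul T) ≢ 0ℚ ⊎ a (Triangle.vl T) ≢ 0ℚ
  supportNode⇒Triangle {e = e} supported e:uv l∈V l≢u l≢v with ∈supportNodes⇒edge l∈V
  ... | f , af≢0 , l∈f with DEdges-through (supported f af≢0) l∈f l≢u l≢v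
  ... | (ul , ul-joins) , (vl , vl-joins) , inj₁ f:ul =
    record { uv = e ; ul = f ; vl = vl ; uv-joins = e:uv ; ul-joins = f:ul ; vl-joins = vl-joins
           ; l≢u = l≢u ; l≢v = l≢v } , inj₁ af≢0
  ... | (ul , ul-joins) , (vl , vl-joins) , inj₂ f:vl =
    record { uv = e ; ul = ul ; vl = f ; uv-joins = e:uv ; ul-joins = ul-joins ; vl-joins = f:vl
           ; l≢u = l≢u ; l≢v = l≢v } , inj₂ af≢0

  module DEdgesSupported (a : EVec G) (a0 : ℚ) (a-valid : ValidOnCuts a a0) {u v : Fin n}
                         (supported : CompletelySupportedBy G a (DEdges G u v)) where

    module AtTriangle {l : Fin n} (T : Triangle u v l) where
      open Triangle T
      open TriangleBound (a ul) (a vl) public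

      u≢v : u ≢ v
      u≢v = Joins⇒≢ uv-joins

      b : EVec G
      b f = single ul (a ul) f + (single vl (a vl) f + single uv γ f)

      rest : EVec G
      rest f = a f - b f

      dot-b-cutVec : ∀ S → dot G b (cutVec G S) ≡ tri (S l xor S u) (S l xor S v)
      dot-b-cutVec S = begin
        dot G b δ
          ≡⟨ dot-+ˡ (single ul (a ul)) (λ f → single vl (a vl) f + single uv γ f) δ ⟩
        dot G (single ul (a ul)) δ + dot G (λ f → single vl (a vl) f + single uv γ f) δ
          ≡⟨ cong (dot G (single ul (a ul)) δ +_) (dot-+ˡ (single vl (a vl)) (single uv γ) δ) ⟩
        dot G (single ul (a ul)) δ + (dot G (single vl (a vl)) δ + dot G (single uv γ) δ)
          ≡⟨ cong₂ _+_ (dot-single ul (a ul) δ)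
                       (cong₂ _+_ (dot-single vl (a vl) δ) (dot-single uv γ δ)) ⟩
        a ul * δ ul + (a vl * δ vl + γ * δ uv)
          ≡⟨ cong₂ _+_ (cong (a ul *_) (cutVec-Joins S (Joins-sym ul-joins)))
                       (cong₂ _+_ (cong (a vl *_) (cutVec-Joins S (Joins-sym vl-joins)))
                                  (cong (γ *_) (trans (cutVec-Joins S uv-joins) uv-cut))) ⟩
        a ul * fromBool (S l xor S u) + (a vl * fromBool (S l xor S v)
          + γ * fromBool ((S l xor S u) xor (S l xor S v)))
          ≡⟨ tri-linear (S l xor S u) (S l xor S v) ⟩
        tri (S l xor S u) (S l xor S v) ∎
        where
        open ≡-Reasoning
        δ : EVec G
        δ = cutVec G S
        uv-cut : fromBool (S u xor S v) ≡ fromBool ((S l xor S u) xor (S l xor S v))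
        uv-cut = cong fromBool (sym (xor-cancelˡ (S l) (S u) (S v)))

      b-valid : ValidOnCuts b top
      b-valid S = ≤-trans (≤-reflexive (dot-b-cutVec S)) (tri≤top (S l xor S u) (S l xor S v))

      b-tight : ∀ S → ∃ λ x → dot G b (cutVec G (S [ l ]≔ x)) ≡ top
      b-tight S with tri-tight (S u) (S v)
      ... | x , tight = x , (begin
        dot G b (cutVec G S′)               ≡⟨ dot-b-cutVec S′ ⟩
        tri (S′ l xor S′ u) (S′ l xor S′ v) ≡⟨ cong₂ tri (cong₂ _xor_ S′l≡x (S′≡S u≢l))
                                                         (cong₂ _xor_ S′l≡x (S′≡S v≢l)) ⟩
        tri (x xor S u) (x xor S v)         ≡⟨ tight ⟩
        top                                 ∎)
        where
        open ≡-Reasoning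
        S′ : Fin n → Bool
        S′ = S [ l ]≔ x
        S′l≡x : S′ l ≡ x
        S′l≡x = updateAt-updates l S
        S′≡S : ∀ {w} → w ≢ l → S′ w ≡ S w
        S′≡S {w} w≢l = updateAt-minimal w l S w≢l
        u≢l : u ≢ l
        u≢l = l≢u ∘ sym
        v≢l : v ≢ l
        v≢l = l≢v ∘ sym

      b-slack : a ul ≢ 0ℚ ⊎ a vl ≢ 0ℚ → ∃ λ S → dot G b (cutVec G S) < top
      b-slack active with tri-slack active
      ... | p , q , slack = S , subst (_< top) (sym (trans (dot-b-cutVec S) tri≡)) slack
        where
        S : Fin n → Bool
        S = ((λ _ → false) [ u ]≔ p) [ v ]≔ q
        tri≡ : tri (S l xor S u) (S l xor S v) ≡ tri p q
        tri≡ = cong₂ tri (cong₂ _xor_ Sl≡false Su≡p) (cong₂ _xor_ Sl≡false Sv≡q)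
          where
          Sl≡false : S l ≡ false
          Sl≡false = trans (updateAt-minimal l v _ (l≢v)) (updateAt-minimal l u _ l≢u)
          Su≡p : S u ≡ p
          Su≡p = trans (updateAt-minimal u v _ u≢v) (updateAt-updates u (λ _ → false))
          Sv≡q : S v ≡ q
          Sv≡q = updateAt-updates v ((λ _ → false) [ u ]≔ p)

      b-≡0 : ∀ {f} → ul ≢ f → vl ≢ f → uv ≢ f → b f ≡ 0ℚ
      b-≡0 ul≢f vl≢f uv≢f =
        cong₂ _+_ (single-≢ (a ul) ul≢f) (cong₂ _+_ (single-≢ (a vl) vl≢f) (single-≢ γ uv≢f))

      b-off : ∀ {w} → w ≢ u → w ≢ v → w ≢ l → ∀ f → Endpoint w f → b f ≡ 0ℚ
      b-off w≢u w≢v w≢l f w∈f = b-≡0 (Endpoint⇒≢ ul-joins w≢u w≢l w∈f)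
                                     (Endpoint⇒≢ vl-joins w≢v w≢l w∈f)
                                     (Endpoint⇒≢ uv-joins w≢u w≢v w∈f)

      a-off : ∀ {f} → Endpoint l f → f ≢ ul → f ≢ vl → a f ≡ 0ℚ
      a-off {f} l∈f f≢ul f≢vl = decidable-stable (a f ≟ 0ℚ) λ af≢0 →
        [ (λ f:ul → f≢ul (simple f ul u l f:ul ul-joins))
        , (λ f:vl → f≢vl (simple f vl v l f:vl vl-joins)) ]′
        (proj₂ (proj₂ (DEdges-through (supported f af≢0) l∈f l≢u l≢v)))

      b-ul : b ul ≡ a ul
      b-ul = trans (cong₂ _+_ (single-≡ ul (a ul))
                              (cong₂ _+_ (single-≢ (a vl) vl≢ul) (single-≢ γ uv≢ul)))
                   (+-identityʳ (a ul))
        where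
        vl≢ul : vl ≢ ul
        vl≢ul = Endpoint⇒≢ vl-joins u≢v (l≢u ∘ sym) (Joins⇒Endpointˡ ul-joins)
        uv≢ul : uv ≢ ul
        uv≢ul = Endpoint⇒≢ uv-joins l≢u l≢v (Joins⇒Endpointˡ (Joins-sym ul-joins))

      b-vl : b vl ≡ a vl
      b-vl = trans (cong₂ _+_ (single-≢ (a ul) ul≢vl)
                              (cong₂ _+_ (single-≡ vl (a vl)) (single-≢ γ uv≢vl)))
                   (trans (+-identityˡ _) (+-identityʳ (a vl)))
        where
        ul≢vl : ul ≢ vl
        ul≢vl = Endpoint⇒≢ ul-joins (u≢v ∘ sym) (l≢v ∘ sym) (Joins⇒Endpointˡ vl-joins)
        uv≢vl : uv ≢ vl
        uv≢vl = Endpoint⇒≢ uv-joins l≢u l≢v (Joins⇒Endpointˡ (Joins-sym vl-joins))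

      rest-off-l : ∀ f → Endpoint l f → rest f ≡ 0ℚ
      rest-off-l f l∈f with f Fin.≟ ul | f Fin.≟ vl
      ... | yes refl | _        = p≡q⇒p-q≡0 (sym b-ul)
      ... | no _     | yes refl = p≡q⇒p-q≡0 (sym b-vl)
      ... | no f≢ul  | no f≢vl  = p≡q⇒p-q≡0 (trans (a-off l∈f f≢ul f≢vl)
        (sym (b-≡0 (f≢ul ∘ sym) (f≢vl ∘ sym) (Endpoint⇒≢ uv-joins l≢u l≢v l∈f))))

      rest-valid : ValidOnCuts rest (a0 - top)
      rest-valid S with b-tight S
      ... | x , tight = begin
        dot G rest (cutVec G S)                       ≡⟨ dot-cutVec-[]≔ rest-off-l S x ⟨
        dot G rest (cutVec G S′)                      ≡⟨ dot-subˡ a b (cutVec G S′) ⟩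
        dot G a (cutVec G S′) - dot G b (cutVec G S′) ≡⟨ cong (λ t → dot G a (cutVec G S′) - t) tight ⟩
        dot G a (cutVec G S′) - top                   ≤⟨ +-monoˡ-≤ (- top) (a-valid S′) ⟩
        a0 - top                                      ∎
        where
        open ≤-Reasoning
        S′ : Fin n → Bool
        S′ = S [ l ]≔ x

      Face⇒b-tight : ∀ x → Face G a a0 x → dot G b x ≡ top
      Face⇒b-tight = Face⇒tight {a} {a0} {b} {top} b-valid rest-valid

    cut-tightFor-b-slackFor-a : ∀ {l₁ l₂} (T₁ : Triangle u v l₁) (T₂ : Triangle u v l₂) → l₁ ≢ l₂ →
      a (Triangle.ul T₂) ≢ 0ℚ ⊎ a (Triangle.vl T₂) ≢ 0ℚ →
      ∃ λ S → dot G (AtTriangle.b T₁) (cutVec G S) ≡ AtTriangle.top T₁ × dot G a (cutVec G S) < a0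
    cut-tightFor-b-slackFor-a {l₁} T₁ T₂ l₁≢l₂ active₂ with AtTriangle.b-slack T₂ active₂
    ... | S , slack₂ with AtTriangle.b-tight T₁ S
    ... | x , tight₁ = S′ , tight₁ , (begin-strict
      dot G a (cutVec G S′)
        ≡⟨ dot-split a L₂.b (cutVec G S′) ⟩
      dot G L₂.b (cutVec G S′) + dot G L₂.rest (cutVec G S′)
        ≡⟨ cong (_+ dot G L₂.rest (cutVec G S′)) (dot-cutVec-[]≔ l₁∉T₂ S x) ⟩
      dot G L₂.b (cutVec G S) + dot G L₂.rest (cutVec G S′)
        <⟨ +-mono-<-≤ slack₂ (L₂.rest-valid S′) ⟩
      L₂.top + (a0 - L₂.top)
        ≡⟨ p+[q-p]≡q L₂.top a0 ⟩
      a0 ∎)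
      where
      open ≤-Reasoning
      module L₂ = AtTriangle T₂
      S′ : Fin n → Bool
      S′ = S [ l₁ ]≔ x
      l₁∉T₂ : ∀ f → Endpoint l₁ f → L₂.b f ≡ 0ℚ
      l₁∉T₂ = L₂.b-off (Triangle.l≢u T₁) (Triangle.l≢v T₁) l₁≢l₂

  FacetInducing⇒¬DEdges-supported : ∀ {a a0 e u v} → FacetInducing G a a0 → Joins e u v →
    ∣ supportNodes G a ∣ > 3 → ¬ CompletelySupportedBy G a (DEdges G u v)
  FacetInducing⇒¬DEdges-supported {a} {a0} {u = u} {v}
    (valid , _ , _ , ¬indep₊₂ , face-indep , _) e:uv 3<∣V∣ supported
    with ∣p∣>3⇒two-others (supportNodes G a) u v 3<∣V∣
  ... | l₁ , l₂ , l₁∈V , l₂∈V , l₁≢u , l₁≢v , l₂≢u , l₂≢v , l₁≢l₂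
    with supportNode⇒Triangle supported e:uv l₁∈V l₁≢u l₁≢v
       | supportNode⇒Triangle supported e:uv l₂∈V l₂≢u l₂≢v
  ... | T₁ , active₁ | T₂ , active₂ =
    let (q , q-tight , q-slack) = cut-tightFor-b-slackFor-a T₁ T₂ l₁≢l₂ active₂
        (r , r-slack)           = L₁.b-slack active₁
    in ¬indep₊₂ (HasAffInd-Face+2 {a} {a0} {L₁.b} {L₁.top} face-indep L₁.Face⇒b-tight
                  (cutVec∈CUT q) (cutVec∈CUT r) q-tight (<⇒≢ q-slack) (<⇒≢ r-slack))
    where
    open DEdgesSupported a a0 (Valid⇒ValidOnCuts {a} valid) supported
    module L₁ = AtTriangle T₁

proposition3p14 : (G : Graph) → (a : EVec G) → (a0 : ℚ) →
    FacetInducing G a a0 →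
    (t : ℕ) → (edge : Fin t → Fin (Graph.m G)) → Injective _≡_ _≡_ edge →
    ∣ supportNodes G a ∣ > 3 →
    ∀ (i : Fin t) →
      ¬ CompletelySupportedBy G a
          (DEdges G (proj₁ (Graph.ends G (edge i))) (proj₂ (Graph.ends G (edge i))))
proposition3p14 G a a0 facet _ edge _ 3<∣V∣ i =
  FacetInducing⇒¬DEdges-supported G facet (inj₁ refl) 3<∣V∣
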